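{- Let $H'$ and $G$ be tripartite graphs such that $G$ is obtained from $H'$ by adding at most $|H'|$ pairwise internally vertex disjoint $V(H')$-paths, each of odd length at least $m$, where $m\geq 3$. Then there is a graph $H$ with $H'\subseteq H\subseteq G$ and $|H|\leq 3|H'|$ which has a tripartition $U_1,U_2,U_3$ of its vertex set (into independent sets of $H$) such that each $V(H)$-path in $G-E(H)$ is an odd $U_1$--$U_2$ path of length at least $m-2$.
   Context: $|H|$ denotes the number of vertices of $H$. The length of a path is its number of edges. For a vertex set $A$, an $A$-path is a path with at least one edge whose two endvertices lie in $A$ and none of whose other vertices lie in $A$ (so the added paths have all their internal vertices outside $V(H')$). A $U_1$--$U_2$ path is a path with one endvertex in $U_1$, the other in $U_2$, and no other vertex in $U_1\cup U_2$. $G-E(H)$ denotes the graph with vertex set $V(G)$ and edge set $E(G)\setminus E(H)$. -}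

module Defs where

open import Data.Nat using (ℕ; zero; suc; _+_; _*_; _∸_; _≤_; _<_)
open import Data.Fin using (Fin; toℕ; inject₁; fromℕ) renaming (zero to fzero; suc to fsuc)
open import Data.Fin.Subset using (Subset; _∈_; _∉_; _⊆_; ∣_∣)
open import Data.Bool using (Bool; true; false)
open import Data.Product using (Σ; ∃; _×_; _,_)
open import Data.Sum using (_⊎_)
open import Data.Empty using (⊥)
open import Relation.Binary.PropositionalEquality using (_≡_; _≢_)
open import Function.Definitions using (Injective)

record Graph (n : ℕ) : Set where
  field
    adj      : Fin n → Fin n → Bool
    adj-sym  : ∀ u v → adj u v ≡ adj v u
    loopless : ∀ v → adj v v ≡ false
open Graph public

record Subgraph {n : ℕ} (G : Graph n) : Set where
  field
    V      : Subset n
    E      : Fin n → Fin n → Bool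
    E-sym  : ∀ u v → E u v ≡ E v u
    E⊆G    : ∀ u v → E u v ≡ true → adj G u v ≡ true
    E-ends : ∀ u v → E u v ≡ true → (u ∈ V) × (v ∈ V)
open Subgraph public

∣V∣ : ∀ {n} {G : Graph n} → Subgraph G → ℕ
∣V∣ H = ∣ V H ∣

_⊑_ : ∀ {n} {G : Graph n} → Subgraph G → Subgraph G → Set
H₁ ⊑ H₂ = (V H₁ ⊆ V H₂) × (∀ u v → E H₁ u v ≡ true → E H₂ u v ≡ true)

-- Tripartite: a proper colouring with 3 colours (colour classes = independent parts).
Tripartite : ∀ {n} → (Fin n → Fin n → Set) → Set
Tripartite {n} R = Σ (Fin n → Fin 3) λ c → ∀ u v → R u v → c u ≢ c v

Odd : ℕ → Set
Odd k = ∃ λ j → k ≡ suc (2 * j)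

record Path {n : ℕ} (R : Fin n → Fin n → Set) : Set where
  field
    len  : ℕ
    vtx  : Fin (suc len) → Fin n
    inj  : Injective _≡_ _≡_ vtx
    step : ∀ (i : Fin len) → R (vtx (inject₁ i)) (vtx (fsuc i))
open Path public

start end : ∀ {n} {R : Fin n → Fin n → Set} → Path R → Fin n
start P = vtx P fzero
end P = vtx P (fromℕ (len P))

Internal : ∀ {n} {R : Fin n → Fin n → Set} → Path R → Fin n → Set
Internal P v = Σ (Fin (suc (len P))) λ i → (0 < toℕ i) × (toℕ i < len P) × (vtx P i ≡ v)

IsAPath : ∀ {n} {R : Fin n → Fin n → Set} → Subset n → Path R → Set
IsAPath A P = (1 ≤ len P) × (start P ∈ A) × (end P ∈ A)
            × (∀ v → Internal P v → v ∉ A)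

EdgeOf : ∀ {n} {R : Fin n → Fin n → Set} → Path R → Fin n → Fin n → Set
EdgeOf P u v = Σ (Fin (len P)) λ i →
  ((vtx P (inject₁ i) ≡ u) × (vtx P (fsuc i) ≡ v)) ⊎ ((vtx P (inject₁ i) ≡ v) × (vtx P (fsuc i) ≡ u))

AdjG : ∀ {n} → Graph n → Fin n → Fin n → Set
AdjG G u v = adj G u v ≡ true

AdjMinus : ∀ {n} (G : Graph n) → Subgraph G → Fin n → Fin n → Set
AdjMinus G H u v = (adj G u v ≡ true) × (E H u v ≡ false)

ObtainedByPaths : ∀ {n} (G : Graph n) → Subgraph G → ℕ → Set
ObtainedByPaths {n} G H' m =
  Σ ℕ λ k → Σ (Fin k → Path (AdjG G)) λ P →
      (k ≤ ∣V∣ H')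
    × (∀ i → IsAPath (V H') (P i))
    × (∀ i → Odd (len (P i)) × (m ≤ len (P i)))
    × (∀ i j → i ≢ j → ∀ v → Internal (P i) v → Internal (P j) v → ⊥)
    × (∀ v → (v ∈ V H') ⊎ (∃ λ i → Internal (P i) v))
    × (∀ u v → adj G u v ≡ true → (E H' u v ≡ true) ⊎ (∃ λ i → EdgeOf (P i) u v))

-- Let G arise from H' by adding paths P i, each an odd V(H')-path of length
-- ℓ ≥ m ≥ 3 with ends coloured x and y by the colouring c of H'.  Cut P i into a start
-- ramp, a bare segment and an end ramp: the ramps have at most two edges in total, the
-- start ramp can be properly coloured from x to colour 0 and the end ramp from y to
-- colour 1 (Ramp, choose-cut).  H is the subgraph of G induced by V(H') together with the
-- internal vertices of all ramps -- at most two per path, whence |H| ≤ 3|H'| -- and U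
-- extends c along the ramps, so U properly colours H.  The interior of a bare segment lies
-- outside H and its vertices have no G-neighbours besides their path neighbours, so a
-- V(H)-path of G − E(H), which has at least two edges as H is induced, enters a segment
-- and must traverse it entirely (Segments.traverse).  It is therefore odd, of length
-- ℓ or ℓ − 2 ≥ m − 2, and joins colour 0 to colour 1.

module Submission where

open import Defs
open import Data.Nat using (ℕ; zero; suc; _+_; _*_; _∸_; _≤_; _<_; z≤n; s≤s; s≤s⁻¹; _≤?_)
open import Data.Nat.Properties
open import Data.Fin using (Fin; toℕ; inject₁; fromℕ; fromℕ<) renaming (zero to fzero; suc to fsuc)
open import Data.Fin.Properties using (toℕ-inject₁; toℕ-fromℕ<; toℕ<n) renaming (_≟_ to _≟ᶠ_)
open import Data.Fin.Subset using (Subset; _∈_; _∉_; ∣_∣; _∪_; ⁅_⁆) renaming (⊥ to ∅)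
open import Data.Fin.Subset.Properties using (∣⊥∣≡0; ∉⊥; p⊆p∪q; q⊆p∪q; x∈p∪q⁻; ∣⁅x⁆∣≡1; x∈⁅x⁆; x∈⁅y⁆⇒x≡y)
open import Data.Vec using ([]; _∷_; lookup)
open import Data.Vec.Properties using ([]=⇒lookup; lookup⇒[]=)
open import Data.Bool using (Bool; true; false; _∧_)
open import Data.Product using (Σ; ∃; _×_; _,_; proj₁; proj₂; swap)
open import Data.Sum using (_⊎_; inj₁; inj₂)
open import Data.Empty using (⊥; ⊥-elim)
open import Relation.Binary.PropositionalEquality
open import Relation.Nullary using (yes; no)

-- Position j of a path of length l, as an element of Fin (suc l); positions beyond l
-- are clamped to l.  This lets us index path vertices by natural numbers.
clamp : (l j : ℕ) → Fin (suc l)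
clamp l       zero    = fzero
clamp zero    (suc j) = fzero
clamp (suc l) (suc j) = fsuc (clamp l j)

toℕ-clamp : ∀ l j → j ≤ l → toℕ (clamp l j) ≡ j
toℕ-clamp l       zero    _       = refl
toℕ-clamp (suc l) (suc j) (s≤s p) = cong suc (toℕ-clamp l j p)

clamp-toℕ : ∀ l (i : Fin (suc l)) → clamp l (toℕ i) ≡ i
clamp-toℕ l       fzero    = refl
clamp-toℕ (suc l) (fsuc i) = cong fsuc (clamp-toℕ l i)

clamp-≥ : ∀ l j → l ≤ j → clamp l j ≡ fromℕ l
clamp-≥ zero    zero    _       = refl
clamp-≥ zero    (suc j) _       = refl
clamp-≥ (suc l) (suc j) (s≤s p) = cong fsuc (clamp-≥ l j p)

clamp-inject₁ : ∀ l (i : Fin l) → clamp l (toℕ i) ≡ inject₁ i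
clamp-inject₁ l i = trans (cong (clamp l) (sym (toℕ-inject₁ i))) (clamp-toℕ l (inject₁ i))

_at_ : ∀ {n} {R : Fin n → Fin n → Set} → Path R → ℕ → Fin n
Q at j = vtx Q (clamp (len Q) j)

module _ {n} {R : Fin n → Fin n → Set} (Q : Path R) where

  at-step : ∀ t → t < len Q → R (Q at t) (Q at suc t)
  at-step t t<l =
    subst₂ R (cong (vtx Q) (trans (sym (clamp-inject₁ _ i)) (cong (clamp _) ti)))
             (cong (vtx Q) (trans (sym (clamp-toℕ _ (fsuc i))) (cong (λ x → clamp _ (suc x)) ti)))
             (step Q i)
    where
      i = fromℕ< t<l
      ti = toℕ-fromℕ< t<l

  at-injective : ∀ s t → s ≤ len Q → t ≤ len Q → Q at s ≡ Q at t → s ≡ t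
  at-injective s t s≤l t≤l e =
    trans (sym (toℕ-clamp _ s s≤l)) (trans (cong toℕ (inj Q e)) (toℕ-clamp _ t t≤l))

  at-end : ∀ j → len Q ≤ j → Q at j ≡ end Q
  at-end j l≤j = cong (vtx Q) (clamp-≥ _ j l≤j)

  at-internal : ∀ t → 0 < t → t < len Q → Internal Q (Q at t)
  at-internal t 0<t t<l =
    clamp _ t , subst (0 <_) (sym tc) 0<t , subst (_< len Q) (sym tc) t<l , refl
    where tc = toℕ-clamp _ t (<⇒≤ t<l)

  internal-position : ∀ {v} → Internal Q v → Σ ℕ λ t → 0 < t × t < len Q × Q at t ≡ v
  internal-position (i , 0<i , i<l , e) =
    toℕ i , 0<i , i<l , trans (cong (vtx Q) (clamp-toℕ _ i)) e

  edge-position : ∀ {u v} → EdgeOf Q u v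
    → Σ ℕ λ t → t < len Q × (((Q at t ≡ u) × (Q at suc t ≡ v)) ⊎ ((Q at t ≡ v) × (Q at suc t ≡ u)))
  edge-position (i , e) = toℕ i , toℕ<n i , orient e
    where
      here : Q at toℕ i ≡ vtx Q (inject₁ i)
      here = cong (vtx Q) (clamp-inject₁ _ i)
      next : Q at suc (toℕ i) ≡ vtx Q (fsuc i)
      next = cong (vtx Q) (clamp-toℕ _ (fsuc i))
      orient : ∀ {u v} → ((vtx Q (inject₁ i) ≡ u) × (vtx Q (fsuc i) ≡ v)) ⊎ ((vtx Q (inject₁ i) ≡ v) × (vtx Q (fsuc i) ≡ u))
             → ((Q at toℕ i ≡ u) × (Q at suc (toℕ i) ≡ v)) ⊎ ((Q at toℕ i ≡ v) × (Q at suc (toℕ i) ≡ u))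
      orient (inj₁ (x , y)) = inj₁ (trans here x , trans next y)
      orient (inj₂ (x , y)) = inj₂ (trans here x , trans next y)

  at-avoids : ∀ {S} → IsAPath S Q → ∀ t → 0 < t → t < len Q → Q at t ∉ S
  at-avoids (_ , _ , _ , avoid) t 0<t t<l = avoid _ (at-internal t 0<t t<l)

∣p∪q∣≤∣p∣+∣q∣ : ∀ {n} (p q : Subset n) → ∣ p ∪ q ∣ ≤ ∣ p ∣ + ∣ q ∣
∣p∪q∣≤∣p∣+∣q∣ []          []          = z≤n
∣p∪q∣≤∣p∣+∣q∣ (true ∷ p)  (true ∷ q)  = s≤s (≤-trans (∣p∪q∣≤∣p∣+∣q∣ p q) (+-monoʳ-≤ ∣ p ∣ (n≤1+n _)))
∣p∪q∣≤∣p∣+∣q∣ (true ∷ p)  (false ∷ q) = s≤s (∣p∪q∣≤∣p∣+∣q∣ p q)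
∣p∪q∣≤∣p∣+∣q∣ (false ∷ p) (true ∷ q)  = ≤-trans (s≤s (∣p∪q∣≤∣p∣+∣q∣ p q)) (≤-reflexive (sym (+-suc _ _)))
∣p∪q∣≤∣p∣+∣q∣ (false ∷ p) (false ∷ q) = ∣p∪q∣≤∣p∣+∣q∣ p q

⋃ᶠ : ∀ {n} k → (Fin k → Subset n) → Subset n
⋃ᶠ zero    K = ∅
⋃ᶠ (suc k) K = K fzero ∪ ⋃ᶠ k (λ i → K (fsuc i))

∈⋃ᶠ⁺ : ∀ {n} k (K : Fin k → Subset n) i {x} → x ∈ K i → x ∈ ⋃ᶠ k K
∈⋃ᶠ⁺ (suc k) K fzero    x∈ = p⊆p∪q _ x∈
∈⋃ᶠ⁺ (suc k) K (fsuc i) x∈ = q⊆p∪q (K fzero) _ (∈⋃ᶠ⁺ k _ i x∈)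

∈⋃ᶠ⁻ : ∀ {n} k (K : Fin k → Subset n) {x} → x ∈ ⋃ᶠ k K → ∃ λ i → x ∈ K i
∈⋃ᶠ⁻ zero    K x∈ = ⊥-elim (∉⊥ x∈)
∈⋃ᶠ⁻ (suc k) K x∈ with x∈p∪q⁻ (K fzero) _ x∈
... | inj₁ x∈K₀ = fzero , x∈K₀
... | inj₂ x∈⋃ with ∈⋃ᶠ⁻ k _ x∈⋃
...   | i , x∈Kᵢ = fsuc i , x∈Kᵢ

∣⋃ᶠ∣≤ : ∀ {n} k (K : Fin k → Subset n) {s} → (∀ i → ∣ K i ∣ ≤ s) → ∣ ⋃ᶠ k K ∣ ≤ k * s
∣⋃ᶠ∣≤ {n} zero    K bound = ≤-reflexive (∣⊥∣≡0 n)
∣⋃ᶠ∣≤     (suc k) K bound =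
  ≤-trans (∣p∪q∣≤∣p∣+∣q∣ (K fzero) _) (+-mono-≤ (bound fzero) (∣⋃ᶠ∣≤ k _ (λ i → bound (fsuc i))))

odd-∸2 : ∀ {ℓ} → Odd ℓ → 3 ≤ ℓ → Odd (ℓ ∸ 2)
odd-∸2 (zero  , refl) (s≤s ())
odd-∸2 (suc h , refl) _ = h , +-suc h (h + 0)

induced : ∀ {n} (G : Graph n) → Subset n → Subgraph G
induced {n} G S = record
  { V = S ; E = edge ; E-sym = edge-sym
  ; E⊆G = λ u v e → proj₂ (proj₂ (edge⁻ u v e))
  ; E-ends = λ u v e → proj₁ (edge⁻ u v e) , proj₁ (proj₂ (edge⁻ u v e)) }
  where
    edge : Fin n → Fin n → Bool
    edge u v = lookup S u ∧ (lookup S v ∧ adj G u v)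
    edge-sym : ∀ u v → edge u v ≡ edge v u
    edge-sym u v rewrite adj-sym G u v with lookup S u | lookup S v
    ... | true  | true  = refl
    ... | true  | false = refl
    ... | false | true  = refl
    ... | false | false = refl
    edge⁻ : ∀ u v → edge u v ≡ true → (u ∈ S) × (v ∈ S) × (adj G u v ≡ true)
    edge⁻ u v e with lookup S u in u∈ | lookup S v in v∈
    ... | true | true = lookup⇒[]= u S u∈ , lookup⇒[]= v S v∈ , e

induced-edge : ∀ {n} (G : Graph n) (S : Subset n) {u v} → u ∈ S → v ∈ S → adj G u v ≡ true
               → E (induced G S) u v ≡ true
induced-edge G S {u} {v} u∈S v∈S uv rewrite []=⇒lookup u∈S | []=⇒lookup v∈S | uv = refl

ℓ∸j≡suc[ℓ∸suc-j] : ∀ ℓ j → suc j ≤ ℓ → ℓ ∸ j ≡ suc (ℓ ∸ suc j)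
ℓ∸j≡suc[ℓ∸suc-j] (suc ℓ) j (s≤s j≤ℓ) = +-∸-assoc 1 j≤ℓ

[ℓ∸a]∸[ℓ∸b]≡b∸a : ∀ ℓ a b → a ≤ b → b ≤ ℓ → (ℓ ∸ a) ∸ (ℓ ∸ b) ≡ b ∸ a
[ℓ∸a]∸[ℓ∸b]≡b∸a ℓ       zero    b       _       b≤ℓ       = m∸[m∸n]≡n b≤ℓ
[ℓ∸a]∸[ℓ∸b]≡b∸a (suc ℓ) (suc a) (suc b) (s≤s a≤b) (s≤s b≤ℓ) = [ℓ∸a]∸[ℓ∸b]≡b∸a ℓ a b a≤b b≤ℓ

module Segments {n} (G : Graph n) {R : Fin n → Fin n → Set}
                (R⊆G : ∀ {u v} → R u v → adj G u v ≡ true) (S : Subset n) where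

  -- The bound ℓ is only used to reverse the segment.
  record Segment : Set where
    field
      f               : ℕ → Fin n
      a b ℓ           : ℕ
      a<b             : a < b
      b≤ℓ             : b ≤ ℓ
      only-neighbours : ∀ j → a < j → j < b → ∀ w → adj G (f j) w ≡ true
                        → (w ≡ f (j ∸ 1)) ⊎ (w ≡ f (suc j))
      ∈S⇒outside      : ∀ j → f j ∈ S → (j ≤ a) ⊎ (b ≤ j)
      ∉S⇒inside       : ∀ j → f j ∉ S → (a < j) × (j < b)

  reverse : Segment → Segment
  reverse σ = record
    { f = λ j → f (ℓ ∸ j) ; a = ℓ ∸ b ; b = ℓ ∸ a ; ℓ = ℓ
    ; a<b = ∸-monoʳ-< a<b b≤ℓ
    ; b≤ℓ = m∸n≤m ℓ a
    ; only-neighbours = only-neighbours′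
    ; ∈S⇒outside = ∈S⇒outside′
    ; ∉S⇒inside = ∉S⇒inside′ }
    where
      open Segment σ
      only-neighbours′ : ∀ j → ℓ ∸ b < j → j < ℓ ∸ a → ∀ w → adj G (f (ℓ ∸ j)) w ≡ true
                         → (w ≡ f (ℓ ∸ (j ∸ 1))) ⊎ (w ≡ f (ℓ ∸ suc j))
      only-neighbours′ (suc j) ℓ∸b<j j<ℓ∸a w e
        with only-neighbours (ℓ ∸ suc j) a<ℓ∸j ℓ∸j<b w e
        where
          j≤ℓ : suc j ≤ ℓ
          j≤ℓ = ≤-trans (<⇒≤ j<ℓ∸a) (m∸n≤m ℓ a)
          a<ℓ∸j : a < ℓ ∸ suc j
          a<ℓ∸j = ∸-cancelʳ-< {o = ℓ} (subst (_< ℓ ∸ a) (sym (m∸[m∸n]≡n j≤ℓ)) j<ℓ∸a)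
          ℓ∸j<b : ℓ ∸ suc j < b
          ℓ∸j<b = ∸-cancelʳ-< {o = ℓ} (subst (ℓ ∸ b <_) (sym (m∸[m∸n]≡n j≤ℓ)) ℓ∸b<j)
      ... | inj₁ w≡pred = inj₂ (trans w≡pred (cong f (pred[m∸n]≡m∸[1+n] ℓ (suc j))))
      ... | inj₂ w≡succ = inj₁ (trans w≡succ (cong f (sym (ℓ∸j≡suc[ℓ∸suc-j] ℓ j
                             (≤-trans (<⇒≤ j<ℓ∸a) (m∸n≤m ℓ a))))))
      ∈S⇒outside′ : ∀ j → f (ℓ ∸ j) ∈ S → (j ≤ ℓ ∸ b) ⊎ (ℓ ∸ a ≤ j)
      ∈S⇒outside′ j x with j ≤? ℓ
      ... | no j≰ℓ = inj₂ (≤-trans (m∸n≤m ℓ a) (<⇒≤ (≰⇒> j≰ℓ)))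
      ... | yes j≤ℓ with ∈S⇒outside (ℓ ∸ j) x
      ...   | inj₁ ℓ∸j≤a = inj₂ (subst (ℓ ∸ a ≤_) (m∸[m∸n]≡n j≤ℓ) (∸-monoʳ-≤ ℓ ℓ∸j≤a))
      ...   | inj₂ b≤ℓ∸j = inj₁ (subst (_≤ ℓ ∸ b) (m∸[m∸n]≡n j≤ℓ) (∸-monoʳ-≤ ℓ b≤ℓ∸j))
      ∉S⇒inside′ : ∀ j → f (ℓ ∸ j) ∉ S → (ℓ ∸ b < j) × (j < ℓ ∸ a)
      ∉S⇒inside′ j x with j ≤? ℓ | ∉S⇒inside (ℓ ∸ j) x
      ... | no j≰ℓ | (a<ℓ∸j , _) =
            ⊥-elim (<⇒≢ (≤-<-trans z≤n a<ℓ∸j) (sym (m≤n⇒m∸n≡0 (<⇒≤ (≰⇒> j≰ℓ)))))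
      ... | yes j≤ℓ | (a<ℓ∸j , ℓ∸j<b) =
              subst (ℓ ∸ b <_) (m∸[m∸n]≡n j≤ℓ) (∸-monoʳ-< ℓ∸j<b b≤ℓ)
            , subst (_< ℓ ∸ a) (m∸[m∸n]≡n j≤ℓ) (∸-monoʳ-< a<ℓ∸j (m∸n≤m ℓ j))

  module _ (σ : Segment) where
    open Segment σ

    leave-at-a : ∀ j → f j ∈ S → f (suc j) ∉ S → j ≡ a
    leave-at-a j f-j∈S f-sj∉S with ∈S⇒outside j f-j∈S | ∉S⇒inside (suc j) f-sj∉S
    ... | inj₁ j≤a | (a<sj , _)  = ≤-antisym j≤a (s≤s⁻¹ a<sj)
    ... | inj₂ b≤j | (_ , sj<b) = ⊥-elim (<-irrefl refl (≤-<-trans b≤j (<-trans (n<1+n j) sj<b)))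

    enter-at-b : ∀ j → f j ∉ S → f (suc j) ∈ S → suc j ≡ b
    enter-at-b j f-j∉S f-sj∈S with ∉S⇒inside j f-j∉S | ∈S⇒outside (suc j) f-sj∈S
    ... | (a<j , _)  | inj₁ sj≤a = ⊥-elim (<-irrefl refl (<-≤-trans a<j (≤-trans (n≤1+n j) sj≤a)))
    ... | (_ , j<b) | inj₂ b≤sj = ≤-antisym j<b b≤sj

    module _ (Q : Path R) (Q-is-S-path : IsAPath S Q) (2≤len : 2 ≤ len Q) where

      go-on : ∀ t j → suc (suc t) ≤ len Q → Q at t ≡ f j → Q at suc t ≡ f (suc j)
              → Q at suc (suc t) ≡ f (suc (suc j))
      go-on t j t+2≤len here next
        with ∉S⇒inside (suc j) (λ x → at-avoids Q Q-is-S-path (suc t) (s≤s z≤n) t+2≤len (subst (_∈ S) (sym next) x))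
      ... | (a<sj , sj<b)
        with only-neighbours (suc j) a<sj sj<b _ (subst (λ v → adj G v _ ≡ true) next (R⊆G (at-step Q (suc t) t+2≤len)))
      ...   | inj₂ forwards = forwards
      ...   | inj₁ backwards =
              ⊥-elim (<-irrefl (sym t+2≡t) (<-trans (n<1+n t) (n<1+n (suc t))))
        where
          t+2≡t : suc (suc t) ≡ t
          t+2≡t = at-injective Q _ _ t+2≤len (≤-trans (n≤1+n _) (≤-trans (n≤1+n _) t+2≤len))
                                (trans backwards (sym here))

      traverse-forwards : ∀ j₀ → Q at 0 ≡ f j₀ → Q at 1 ≡ f (suc j₀)
                          → (len Q ≡ b ∸ a) × (start Q ≡ f a) × (end Q ≡ f b)
      traverse-forwards j₀ first second =
        len-eq , trans first (cong f j₀≡a) , trans (sym (at-end Q _ (≤-reflexive (sym len≡)))) (trans last (cong f L+2+j₀≡b))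
        where
          L : ℕ
          L = len Q ∸ 2
          len≡ : suc (suc L) ≡ len Q
          len≡ = trans (+-comm 2 L) (m∸n+n≡m 2≤len)
          follow : ∀ t → suc t ≤ len Q → (Q at t ≡ f (t + j₀)) × (Q at suc t ≡ f (suc t + j₀))
          follow zero    _  = first , second
          follow (suc t) le = let (here , next) = follow t (≤-trans (n≤1+n _) le)
                              in next , go-on t (t + j₀) le here next
          last : Q at suc (suc L) ≡ f (suc (suc L) + j₀)
          last = proj₂ (follow (suc L) (≤-reflexive len≡))
          j₀≡a : j₀ ≡ a
          j₀≡a = leave-at-a j₀ (subst (_∈ S) first (proj₁ (proj₂ Q-is-S-path)))
                   (λ x → at-avoids Q Q-is-S-path 1 (s≤s z≤n) 2≤len (subst (_∈ S) (sym second) x))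
          L+2+j₀≡b : suc (suc L) + j₀ ≡ b
          L+2+j₀≡b = enter-at-b (suc L + j₀)
            (λ x → at-avoids Q Q-is-S-path (suc L) (s≤s z≤n) (≤-reflexive len≡)
                     (subst (_∈ S) (sym (proj₁ (follow (suc L) (≤-reflexive len≡)))) x))
            (subst (_∈ S) (trans (sym (at-end Q _ (≤-reflexive (sym len≡)))) last) (proj₁ (proj₂ (proj₂ Q-is-S-path))))
          len-eq : len Q ≡ b ∸ a
          len-eq = begin
            len Q                   ≡⟨ sym len≡ ⟩
            suc (suc L)             ≡⟨ sym (m+n∸n≡m (suc (suc L)) a) ⟩
            suc (suc L) + a ∸ a     ≡⟨ cong (λ x → suc (suc L) + x ∸ a) (sym j₀≡a) ⟩
            suc (suc L) + j₀ ∸ a    ≡⟨ cong (_∸ a) L+2+j₀≡b ⟩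
            b ∸ a                   ∎
            where open ≡-Reasoning

  traverse : (σ : Segment) → let open Segment σ in
             (Q : Path R) → IsAPath S Q → 2 ≤ len Q → ∀ j → a < j → j < b → Q at 1 ≡ f j
             → (len Q ≡ b ∸ a)
               × (((start Q ≡ f a) × (end Q ≡ f b)) ⊎ ((start Q ≡ f b) × (end Q ≡ f a)))
  traverse σ Q Q-is-S-path 2≤len j a<j j<b second
    with only-neighbours j a<j j<b (Q at 0)
           (trans (adj-sym G _ _) (subst (λ v → adj G _ v ≡ true) second (R⊆G (at-step Q 0 (≤-trans (s≤s z≤n) 2≤len)))))
    where open Segment σ
  ... | inj₁ first-behind
    with traverse-forwards σ Q Q-is-S-path 2≤len (j ∸ 1) first-behind (trans second (cong f (sym suc[j∸1]≡j)))
    where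
      open Segment σ
      suc[j∸1]≡j : suc (j ∸ 1) ≡ j
      suc[j∸1]≡j = trans (+-comm 1 (j ∸ 1)) (m∸n+n≡m (≤-trans (s≤s z≤n) a<j))
  ...   | (len≡ , start≡ , end≡) = len≡ , inj₁ (start≡ , end≡)
  traverse σ Q Q-is-S-path 2≤len j a<j j<b second | inj₂ first-ahead
    with traverse-forwards (reverse σ) Q Q-is-S-path 2≤len (ℓ ∸ suc j)
           (trans first-ahead (cong f (sym (m∸[m∸n]≡n sj≤ℓ))))
           (trans second (cong f (sym (trans (cong (ℓ ∸_) (sym (ℓ∸j≡suc[ℓ∸suc-j] ℓ j sj≤ℓ))) (m∸[m∸n]≡n (<⇒≤ sj≤ℓ))))))
    where
      open Segment σ
      sj≤ℓ : suc j ≤ ℓ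
      sj≤ℓ = ≤-trans j<b b≤ℓ
  ... | (len≡ , start≡ , end≡) =
        trans len≡ ([ℓ∸a]∸[ℓ∸b]≡b∸a ℓ a b (<⇒≤ a<b) b≤ℓ)
      , inj₂ (trans start≡ (cong f (m∸[m∸n]≡n b≤ℓ)) , trans end≡ (cong f (m∸[m∸n]≡n (≤-trans (<⇒≤ a<b) b≤ℓ))))
    where open Segment σ

other : Fin 3 → Fin 3 → Fin 3
other fzero               fzero               = fsuc fzero
other fzero               (fsuc fzero)        = fsuc (fsuc fzero)
other fzero               (fsuc (fsuc fzero)) = fsuc fzero
other (fsuc fzero)        fzero               = fsuc (fsuc fzero)
other (fsuc fzero)        (fsuc fzero)        = fzero
other (fsuc fzero)        (fsuc (fsuc fzero)) = fzero
other (fsuc (fsuc fzero)) fzero               = fsuc fzero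
other (fsuc (fsuc fzero)) (fsuc fzero)        = fzero
other (fsuc (fsuc fzero)) (fsuc (fsuc fzero)) = fzero

other-≢ : ∀ c d → (other c d ≢ c) × (other c d ≢ d)
other-≢ fzero               fzero               = (λ ()) , (λ ())
other-≢ fzero               (fsuc fzero)        = (λ ()) , (λ ())
other-≢ fzero               (fsuc (fsuc fzero)) = (λ ()) , (λ ())
other-≢ (fsuc fzero)        fzero               = (λ ()) , (λ ())
other-≢ (fsuc fzero)        (fsuc fzero)        = (λ ()) , (λ ())
other-≢ (fsuc fzero)        (fsuc (fsuc fzero)) = (λ ()) , (λ ())
other-≢ (fsuc (fsuc fzero)) fzero               = (λ ()) , (λ ())
other-≢ (fsuc (fsuc fzero)) (fsuc fzero)        = (λ ()) , (λ ())
other-≢ (fsuc (fsuc fzero)) (fsuc (fsuc fzero)) = (λ ()) , (λ ())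

-- `ramp c t s` colours the positions 0 … s of a path of length s ≤ 2 from c to t.
ramp : (c t : Fin 3) (s r : ℕ) → Fin 3
ramp c t s             zero          = c
ramp c t zero          (suc r)       = t
ramp c t (suc zero)    (suc r)       = t
ramp c t (suc (suc s)) (suc zero)    = other c t
ramp c t (suc (suc s)) (suc (suc r)) = t

-- The lengths for which `ramp c t` is a proper colouring ending in t.
data Ramp (c t : Fin 3) : ℕ → Set where
  flat   : c ≡ t → Ramp c t 0
  direct : c ≢ t → Ramp c t 1
  detour : Ramp c t 2

ramp-end : ∀ {c t s} → Ramp c t s → ramp c t s s ≡ t
ramp-end (flat c≡t)   = c≡t
ramp-end (direct _)   = refl
ramp-end detour       = refl

ramp-proper : ∀ {c t s} → Ramp c t s → ∀ r → r < s → ramp c t s r ≢ ramp c t s (suc r)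
ramp-proper (direct c≢t)   zero          _                 = c≢t
ramp-proper (direct _)     (suc r)       (s≤s ())
ramp-proper {c} {t} detour zero          _                 = λ e → proj₁ (other-≢ c t) (sym e)
ramp-proper {c} {t} detour (suc zero)    _                 = proj₂ (other-≢ c t)
ramp-proper detour         (suc (suc r)) (s≤s (s≤s ()))

-- How an added path of length ℓ is cut: the first `startRamp κ` and the last `endRamp κ`
-- edges become ramps recoloured into H, the positions in between form a bare segment.
data Cut : Set where
  whole trim-end trim-start trim-both : Cut

startRamp endRamp : Cut → ℕ
startRamp whole      = 0
startRamp trim-end   = 0
startRamp trim-start = 2
startRamp trim-both  = 1
endRamp whole      = 0
endRamp trim-end   = 2
endRamp trim-start = 0
endRamp trim-both  = 1

choose-cut : (x y : Fin 3) → Σ Cut λ κ → Ramp x fzero (startRamp κ) × Ramp y (fsuc fzero) (endRamp κ)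
choose-cut x y with x ≟ᶠ fzero | y ≟ᶠ fsuc fzero
... | yes x≡0 | yes y≡1 = whole      , flat x≡0     , flat y≡1
... | yes x≡0 | no  y≢1 = trim-end   , flat x≡0     , detour
... | no  x≢0 | yes y≡1 = trim-start , detour       , flat y≡1
... | no  x≢0 | no  y≢1 = trim-both  , direct x≢0   , direct y≢1

OnRamp : Cut → ℕ → ℕ → Set
OnRamp κ ℓ j = (j ≤ startRamp κ) ⊎ (ℓ ∸ endRamp κ ≤ j)

-- Two positions whose vertices are added to H; with the two ends they make up all positions
-- on the ramps (for the whole path they are the ends themselves).
kept₁ kept₂ : Cut → ℕ → ℕ
kept₁ whole      ℓ = ℓ
kept₁ trim-end   ℓ = ℓ ∸ 2
kept₁ trim-start _ = 1
kept₁ trim-both  _ = 1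
kept₂ whole      _ = 0
kept₂ trim-end   ℓ = ℓ ∸ 1
kept₂ trim-start _ = 2
kept₂ trim-both  ℓ = ℓ ∸ 1

Kept : Cut → ℕ → ℕ → Set
Kept κ ℓ j = (j ≡ kept₁ κ ℓ) ⊎ (j ≡ kept₂ κ ℓ)

j≡x⊎j≡x+1 : ∀ x j → x ≤ j → j < suc (suc x) → (j ≡ x) ⊎ (j ≡ suc x)
j≡x⊎j≡x+1 zero    zero          _       _                = inj₁ refl
j≡x⊎j≡x+1 zero    (suc zero)    _       _                = inj₂ refl
j≡x⊎j≡x+1 zero    (suc (suc j)) _       (s≤s (s≤s ()))
j≡x⊎j≡x+1 (suc x) (suc j)       (s≤s p) (s≤s q) with j≡x⊎j≡x+1 x j p q
... | inj₁ e = inj₁ (cong suc e)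
... | inj₂ e = inj₂ (cong suc e)

ramps-disjoint : ∀ κ {ℓ} → 3 ≤ ℓ → startRamp κ < ℓ ∸ endRamp κ
ramps-disjoint whole      (s≤s (s≤s (s≤s _))) = s≤s z≤n
ramps-disjoint trim-end   (s≤s (s≤s (s≤s _))) = s≤s z≤n
ramps-disjoint trim-start (s≤s (s≤s (s≤s _))) = s≤s (s≤s (s≤s z≤n))
ramps-disjoint trim-both  (s≤s (s≤s (s≤s _))) = s≤s (s≤s z≤n)

endRamp≤ℓ : ∀ κ {ℓ} → 3 ≤ ℓ → endRamp κ ≤ ℓ
endRamp≤ℓ whole      (s≤s (s≤s (s≤s _))) = z≤n
endRamp≤ℓ trim-end   (s≤s (s≤s (s≤s _))) = s≤s (s≤s z≤n)
endRamp≤ℓ trim-start (s≤s (s≤s (s≤s _))) = z≤n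
endRamp≤ℓ trim-both  (s≤s (s≤s (s≤s _))) = s≤s z≤n

on-ramp⇒kept : ∀ κ {ℓ} → 3 ≤ ℓ → ∀ j → 0 < j → j < ℓ → OnRamp κ ℓ j → Kept κ ℓ j
on-ramp⇒kept whole      (s≤s (s≤s (s≤s _))) j 0<j j<ℓ (inj₁ j≤0) = ⊥-elim (<-irrefl refl (<-≤-trans 0<j j≤0))
on-ramp⇒kept whole      (s≤s (s≤s (s≤s _))) j 0<j j<ℓ (inj₂ ℓ≤j) = ⊥-elim (<-irrefl refl (<-≤-trans j<ℓ ℓ≤j))
on-ramp⇒kept trim-end   (s≤s (s≤s (s≤s _))) j 0<j j<ℓ (inj₁ j≤0) = ⊥-elim (<-irrefl refl (<-≤-trans 0<j j≤0))
on-ramp⇒kept trim-end   (s≤s (s≤s (s≤s {n = L} _))) j 0<j j<ℓ (inj₂ ℓ-2≤j) = j≡x⊎j≡x+1 (suc L) j ℓ-2≤j j<ℓ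
on-ramp⇒kept trim-start (s≤s (s≤s (s≤s _))) j 0<j j<ℓ (inj₁ j≤2) = j≡x⊎j≡x+1 1 j 0<j (s≤s j≤2)
on-ramp⇒kept trim-start (s≤s (s≤s (s≤s _))) j 0<j j<ℓ (inj₂ ℓ≤j) = ⊥-elim (<-irrefl refl (<-≤-trans j<ℓ ℓ≤j))
on-ramp⇒kept trim-both  (s≤s (s≤s (s≤s _))) j 0<j j<ℓ (inj₁ j≤1) = inj₁ (≤-antisym j≤1 0<j)
on-ramp⇒kept trim-both  (s≤s (s≤s (s≤s _))) j 0<j j<ℓ (inj₂ ℓ-1≤j) = inj₂ (≤-antisym (s≤s⁻¹ j<ℓ) ℓ-1≤j)

kept⇒on-ramp : ∀ κ {ℓ} → 3 ≤ ℓ → ∀ j → Kept κ ℓ j → j ≤ ℓ × OnRamp κ ℓ j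
kept⇒on-ramp whole      (s≤s (s≤s (s≤s _))) _ (inj₁ refl) = ≤-refl        , inj₂ ≤-refl
kept⇒on-ramp whole      (s≤s (s≤s (s≤s _))) _ (inj₂ refl) = z≤n           , inj₁ z≤n
kept⇒on-ramp trim-end   (s≤s (s≤s (s≤s _))) _ (inj₁ refl) = m∸n≤m _ 2     , inj₂ ≤-refl
kept⇒on-ramp trim-end   (s≤s (s≤s (s≤s _))) _ (inj₂ refl) = n≤1+n _       , inj₂ (n≤1+n _)
kept⇒on-ramp trim-start (s≤s (s≤s (s≤s _))) _ (inj₁ refl) = s≤s z≤n       , inj₁ (s≤s z≤n)
kept⇒on-ramp trim-start (s≤s (s≤s (s≤s _))) _ (inj₂ refl) = s≤s (s≤s z≤n) , inj₁ ≤-refl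
kept⇒on-ramp trim-both  (s≤s (s≤s (s≤s _))) _ (inj₁ refl) = s≤s z≤n       , inj₁ ≤-refl
kept⇒on-ramp trim-both  (s≤s (s≤s (s≤s _))) _ (inj₂ refl) = n≤1+n _       , inj₂ ≤-refl

segment-length : ∀ κ ℓ → ((ℓ ∸ endRamp κ) ∸ startRamp κ ≡ ℓ) ⊎ ((ℓ ∸ endRamp κ) ∸ startRamp κ ≡ ℓ ∸ 2)
segment-length whole      ℓ = inj₁ refl
segment-length trim-end   ℓ = inj₂ refl
segment-length trim-start ℓ = inj₂ refl
segment-length trim-both  ℓ = inj₂ (∸-+-assoc ℓ 1 1)

module PathColouring (x y : Fin 3) (ℓ : ℕ) (3≤ℓ : 3 ≤ ℓ) where

  κ : Cut
  κ = proj₁ (choose-cut x y)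

  a b : ℕ
  a = startRamp κ
  b = ℓ ∸ endRamp κ

  a<b : a < b
  a<b = ramps-disjoint κ 3≤ℓ

  b≤ℓ : b ≤ ℓ
  b≤ℓ = m∸n≤m ℓ (endRamp κ)

  start-ramp : Ramp x fzero a
  start-ramp = proj₁ (proj₂ (choose-cut x y))

  end-ramp : Ramp y (fsuc fzero) (endRamp κ)
  end-ramp = proj₂ (proj₂ (choose-cut x y))

  -- Positions strictly between a and b are outside H; their colour is irrelevant.
  colour : ℕ → Fin 3
  colour j with j ≤? a | b ≤? j
  ... | yes _ | _     = ramp x fzero a j
  ... | no _  | yes _ = ramp y (fsuc fzero) (endRamp κ) (ℓ ∸ j)
  ... | no _  | no _  = fzero

  colour-start : ∀ j → j ≤ a → colour j ≡ ramp x fzero a j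
  colour-start j j≤a with j ≤? a
  ... | yes _   = refl
  ... | no j≰a  = ⊥-elim (j≰a j≤a)

  colour-end : ∀ j → b ≤ j → colour j ≡ ramp y (fsuc fzero) (endRamp κ) (ℓ ∸ j)
  colour-end j b≤j with j ≤? a | b ≤? j
  ... | yes j≤a | _      = ⊥-elim (<-irrefl refl (<-≤-trans a<b (≤-trans b≤j j≤a)))
  ... | no _    | yes _  = refl
  ... | no _    | no b≰j = ⊥-elim (b≰j b≤j)

  colour-0 : colour 0 ≡ x
  colour-0 = colour-start 0 z≤n

  colour-ℓ : colour ℓ ≡ y
  colour-ℓ = trans (colour-end ℓ b≤ℓ) (cong (ramp y (fsuc fzero) (endRamp κ)) (n∸n≡0 ℓ))

  colour-a : colour a ≡ fzero
  colour-a = trans (colour-start a ≤-refl) (ramp-end start-ramp)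

  colour-b : colour b ≡ fsuc fzero
  colour-b = trans (colour-end b ≤-refl)
                   (trans (cong (ramp y (fsuc fzero) (endRamp κ)) (m∸[m∸n]≡n (endRamp≤ℓ κ 3≤ℓ)))
                          (ramp-end end-ramp))

  colour-proper : ∀ s → suc s ≤ ℓ → OnRamp κ ℓ s → OnRamp κ ℓ (suc s) → colour s ≢ colour (suc s)
  colour-proper s _ _ (inj₁ s+1≤a) same =
    ramp-proper start-ramp s s+1≤a
      (trans (sym (colour-start s (≤-trans (n≤1+n s) s+1≤a))) (trans same (colour-start (suc s) s+1≤a)))
  colour-proper s s+1≤ℓ (inj₂ b≤s) (inj₂ _) same =
    ramp-proper end-ramp r r<endRamp
      (sym (trans (cong (ramp y (fsuc fzero) (endRamp κ)) (sym ℓ∸s≡r+1))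
                  (trans (sym (colour-end s b≤s)) (trans same (colour-end (suc s) (≤-trans b≤s (n≤1+n s)))))))
    where
      r = ℓ ∸ suc s
      ℓ∸s≡r+1 : ℓ ∸ s ≡ suc r
      ℓ∸s≡r+1 = ℓ∸j≡suc[ℓ∸suc-j] ℓ s s+1≤ℓ
      r<endRamp : r < endRamp κ
      r<endRamp = subst (r <_) (m∸[m∸n]≡n (endRamp≤ℓ κ 3≤ℓ)) (∸-monoʳ-< (s≤s b≤s) s+1≤ℓ)
  -- A step from the start ramp to the end ramp is the step from a to b = a + 1, coloured 0 and 1.
  colour-proper s _ (inj₁ s≤a) (inj₂ b≤s+1) same =
    0≢1 (trans (sym colour-a) (trans (cong colour a≡s) (trans same (trans (cong colour s+1≡b) colour-b))))
    where
      0≢1 : fzero ≢ fsuc {2} fzero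
      0≢1 ()
      a≡s : a ≡ s
      a≡s = ≤-antisym (s≤s⁻¹ (<-≤-trans a<b b≤s+1)) s≤a
      s+1≡b : suc s ≡ b
      s+1≡b = ≤-antisym (subst (λ z → suc z ≤ b) a≡s a<b) b≤s+1

module Construction {n} (G : Graph n) (H' : Subgraph G) (m : ℕ) (3≤m : 3 ≤ m)
    (c : Fin n → Fin 3) (c-proper : ∀ u v → E H' u v ≡ true → c u ≢ c v)
    (k : ℕ) (P : Fin k → Path (AdjG G)) (k≤∣H'∣ : k ≤ ∣V∣ H')
    (P-paths : ∀ i → IsAPath (V H') (P i))
    (P-long : ∀ i → Odd (len (P i)) × (m ≤ len (P i)))
    (P-disjoint : ∀ i j → i ≢ j → ∀ v → Internal (P i) v → Internal (P j) v → ⊥)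
    (V-cover : ∀ v → (v ∈ V H') ⊎ (∃ λ i → Internal (P i) v))
    (E-cover : ∀ u v → adj G u v ≡ true → (E H' u v ≡ true) ⊎ (∃ λ i → EdgeOf (P i) u v)) where

  ℓ : Fin k → ℕ
  ℓ i = len (P i)

  3≤ℓ : ∀ i → 3 ≤ ℓ i
  3≤ℓ i = ≤-trans 3≤m (proj₂ (P-long i))

  module C (i : Fin k) = PathColouring (c (start (P i))) (c (end (P i))) (ℓ i) (3≤ℓ i)

  internal∉H' : ∀ i {v} → Internal (P i) v → v ∉ V H'
  internal∉H' i = proj₂ (proj₂ (proj₂ (P-paths i))) _

  end∈H' : ∀ i j → ℓ i ≤ j → P i at j ∈ V H'
  end∈H' i j ℓ≤j = subst (_∈ V H') (sym (at-end (P i) j ℓ≤j)) (proj₁ (proj₂ (proj₂ (P-paths i))))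

  locate : ∀ i′ j′ i j → j′ ≤ ℓ i′ → 0 < j → j < ℓ i → P i′ at j′ ≡ P i at j → (i′ ≡ i) × (j′ ≡ j)
  locate i′ j′ i j j′≤ℓ 0<j j<ℓ same with j′ ≟ 0 | j′ ≟ ℓ i′
  ... | yes refl | _ = ⊥-elim (internal∉H' i (at-internal (P i) j 0<j j<ℓ)
                         (subst (_∈ V H') same (proj₁ (proj₂ (P-paths i′)))))
  ... | no _ | yes refl = ⊥-elim (internal∉H' i (at-internal (P i) j 0<j j<ℓ)
                            (subst (_∈ V H') same (end∈H' i′ (ℓ i′) ≤-refl)))
  ... | no j′≢0 | no j′≢ℓ with i′ ≟ᶠ i
  ...   | no i′≢i  = ⊥-elim (P-disjoint i′ i i′≢i _ (at-internal (P i′) j′ (n≢0⇒n>0 j′≢0) (≤∧≢⇒< j′≤ℓ j′≢ℓ))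
                                (subst (Internal (P i)) (sym same) (at-internal (P i) j 0<j j<ℓ)))
  ...   | yes refl = refl , at-injective (P i) j′ j j′≤ℓ (<⇒≤ j<ℓ) same

  keptVertex₁ keptVertex₂ : Fin k → Fin n
  keptVertex₁ i = P i at kept₁ (C.κ i) (ℓ i)
  keptVertex₂ i = P i at kept₂ (C.κ i) (ℓ i)

  kept : Fin k → Subset n
  kept i = ⁅ keptVertex₁ i ⁆ ∪ ⁅ keptVertex₂ i ⁆

  VH : Subset n
  VH = V H' ∪ ⋃ᶠ k kept

  H : Subgraph G
  H = induced G VH

  H'⊑H : H' ⊑ H
  H'⊑H = p⊆p∪q _ , λ u v e → induced-edge G VH (p⊆p∪q _ (proj₁ (E-ends H' u v e)))
                                              (p⊆p∪q _ (proj₂ (E-ends H' u v e))) (E⊆G H' u v e)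

  -- Each of the at most |H'| paths contributes at most two vertices.
  ∣H∣≤3∣H'∣ : ∣V∣ H ≤ 3 * ∣V∣ H'
  ∣H∣≤3∣H'∣ = begin
    ∣ V H' ∪ ⋃ᶠ k kept ∣       ≤⟨ ∣p∪q∣≤∣p∣+∣q∣ (V H') _ ⟩
    ∣V∣ H' + ∣ ⋃ᶠ k kept ∣     ≤⟨ +-monoʳ-≤ (∣V∣ H') (∣⋃ᶠ∣≤ k kept ∣kept∣≤2) ⟩
    ∣V∣ H' + k * 2             ≤⟨ +-monoʳ-≤ (∣V∣ H') (*-monoˡ-≤ 2 k≤∣H'∣) ⟩
    ∣V∣ H' + ∣V∣ H' * 2        ≡⟨ cong (∣V∣ H' +_) (*-comm (∣V∣ H') 2) ⟩
    3 * ∣V∣ H'                 ∎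
    where
      open ≤-Reasoning
      ∣kept∣≤2 : ∀ i → ∣ kept i ∣ ≤ 2
      ∣kept∣≤2 i = ≤-trans (∣p∪q∣≤∣p∣+∣q∣ ⁅ keptVertex₁ i ⁆ ⁅ keptVertex₂ i ⁆)
                           (≤-reflexive (cong₂ _+_ (∣⁅x⁆∣≡1 (keptVertex₁ i)) (∣⁅x⁆∣≡1 (keptVertex₂ i))))

  on-ramp⇒∈H : ∀ i j → OnRamp (C.κ i) (ℓ i) j → P i at j ∈ VH
  on-ramp⇒∈H i j on-ramp with j ≟ 0 | ℓ i ≤? j
  ... | yes refl | _      = p⊆p∪q _ (proj₁ (proj₂ (P-paths i)))
  ... | no _     | yes ℓ≤j = p⊆p∪q _ (end∈H' i j ℓ≤j)
  ... | no j≢0   | no ℓ≰j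
    with on-ramp⇒kept (C.κ i) (3≤ℓ i) j (n≢0⇒n>0 j≢0) (≰⇒> ℓ≰j) on-ramp
  ...   | inj₁ refl = q⊆p∪q (V H') _ (∈⋃ᶠ⁺ k kept i (p⊆p∪q _ (x∈⁅x⁆ (keptVertex₁ i))))
  ...   | inj₂ refl = q⊆p∪q (V H') _ (∈⋃ᶠ⁺ k kept i (q⊆p∪q ⁅ keptVertex₁ i ⁆ _ (x∈⁅x⁆ (keptVertex₂ i))))

  kept-vertex⇒on-ramp : ∀ i j i′ → 0 < j → j < ℓ i → P i at j ∈ kept i′ → OnRamp (C.κ i) (ℓ i) j
  kept-vertex⇒on-ramp i j i′ 0<j j<ℓ ∈kept = from-kept i′ (x∈p∪q⁻ ⁅ keptVertex₁ i′ ⁆ _ ∈kept)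
    where
      from-position : ∀ i′ e → Kept (C.κ i′) (ℓ i′) e → P i at j ≡ P i′ at e → OnRamp (C.κ i) (ℓ i) j
      from-position i′ e e-kept same with kept⇒on-ramp (C.κ i′) (3≤ℓ i′) e e-kept
      ... | e≤ℓ , on-ramp with locate i′ e i j e≤ℓ 0<j j<ℓ (sym same)
      ...   | refl , refl = on-ramp
      from-kept : ∀ i′ → (P i at j ∈ ⁅ keptVertex₁ i′ ⁆) ⊎ (P i at j ∈ ⁅ keptVertex₂ i′ ⁆) → OnRamp (C.κ i) (ℓ i) j
      from-kept i′ (inj₁ x) = from-position i′ _ (inj₁ refl) (x∈⁅y⁆⇒x≡y _ x)
      from-kept i′ (inj₂ x) = from-position i′ _ (inj₂ refl) (x∈⁅y⁆⇒x≡y _ x)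

  ∈H⇒on-ramp : ∀ i j → P i at j ∈ VH → OnRamp (C.κ i) (ℓ i) j
  ∈H⇒on-ramp i j ∈H with j ≟ 0 | ℓ i ≤? j
  ... | yes refl | _       = inj₁ z≤n
  ... | no _     | yes ℓ≤j = inj₂ (≤-trans (C.b≤ℓ i) ℓ≤j)
  ... | no j≢0   | no ℓ≰j with x∈p∪q⁻ (V H') _ ∈H
  ...   | inj₁ ∈H' = ⊥-elim (internal∉H' i (at-internal (P i) j (n≢0⇒n>0 j≢0) (≰⇒> ℓ≰j)) ∈H')
  ...   | inj₂ ∈⋃ = let (i′ , ∈kept) = ∈⋃ᶠ⁻ k kept ∈⋃
                    in kept-vertex⇒on-ramp i j i′ (n≢0⇒n>0 j≢0) (≰⇒> ℓ≰j) ∈kept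

  ∉H⇒inside : ∀ i j → P i at j ∉ VH → (C.a i < j) × (j < C.b i)
  ∉H⇒inside i j ∉H with j ≤? C.a i | C.b i ≤? j
  ... | yes j≤a | _       = ⊥-elim (∉H (on-ramp⇒∈H i j (inj₁ j≤a)))
  ... | no _    | yes b≤j = ⊥-elim (∉H (on-ramp⇒∈H i j (inj₂ b≤j)))
  ... | no j≰a  | no b≰j  = ≰⇒> j≰a , ≰⇒> b≰j

  path-neighbours : ∀ i j → C.a i < j → j < C.b i → ∀ w → adj G (P i at j) w ≡ true
                    → (w ≡ P i at (j ∸ 1)) ⊎ (w ≡ P i at suc j)
  path-neighbours i j a<j j<b w adjacent with E-cover _ w adjacent
  ... | inj₁ ∈H' = ⊥-elim (internal∉H' i (at-internal (P i) j 0<j j<ℓ) (proj₁ (E-ends H' _ _ ∈H')))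
    where
      0<j = ≤-<-trans z≤n a<j
      j<ℓ = <-≤-trans j<b (C.b≤ℓ i)
  ... | inj₂ (i′ , e) with edge-position (P i′) e
  ...   | t , t<ℓ , inj₁ (here , next)
    with locate i′ t i j (<⇒≤ t<ℓ) (≤-<-trans z≤n a<j) (<-≤-trans j<b (C.b≤ℓ i)) here
  ...     | refl , refl = inj₂ (sym next)
  path-neighbours i j a<j j<b w adjacent | inj₂ (i′ , e) | t , t<ℓ , inj₂ (here , next)
    with locate i′ (suc t) i j t<ℓ (≤-<-trans z≤n a<j) (<-≤-trans j<b (C.b≤ℓ i)) next
  ...     | refl , refl = inj₁ (sym here)

  open Segments G {AdjMinus G H} proj₁ VH

  segment : Fin k → Segment
  segment i = record
    { f = λ j → P i at j ; a = C.a i ; b = C.b i ; ℓ = ℓ i ; a<b = C.a<b i ; b≤ℓ = C.b≤ℓ i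
    ; only-neighbours = path-neighbours i ; ∈S⇒outside = ∈H⇒on-ramp i ; ∉S⇒inside = ∉H⇒inside i }

  colour-by : (v : Fin n) → (v ∈ V H') ⊎ (∃ λ i → Internal (P i) v) → Fin 3
  colour-by v (inj₁ _)           = c v
  colour-by v (inj₂ (i , F , _)) = C.colour i (toℕ F)

  U : Fin n → Fin 3
  U v = colour-by v (V-cover v)

  U-on-H' : ∀ v → v ∈ V H' → U v ≡ c v
  U-on-H' v v∈H' = by-cover (V-cover v)
    where
      by-cover : ∀ z → colour-by v z ≡ c v
      by-cover (inj₁ _)         = refl
      by-cover (inj₂ (i , int)) = ⊥-elim (internal∉H' i int v∈H')

  U-on-path : ∀ i j → j ≤ ℓ i → U (P i at j) ≡ C.colour i j
  U-on-path i j j≤ℓ with j ≟ 0 | j ≟ ℓ i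
  ... | yes refl | _ = trans (U-on-H' _ (proj₁ (proj₂ (P-paths i)))) (sym (C.colour-0 i))
  ... | no _ | yes refl =
    trans (U-on-H' _ (end∈H' i (ℓ i) ≤-refl)) (trans (cong c (at-end (P i) (ℓ i) ≤-refl)) (sym (C.colour-ℓ i)))
  ... | no j≢0 | no j≢ℓ = by-cover (V-cover (P i at j))
    where
      by-cover : ∀ z → colour-by (P i at j) z ≡ C.colour i j
      by-cover (inj₁ ∈H') =
        ⊥-elim (internal∉H' i (at-internal (P i) j (n≢0⇒n>0 j≢0) (≤∧≢⇒< j≤ℓ j≢ℓ)) ∈H')
      by-cover (inj₂ (i′ , int@(F , _)))
        with locate i′ (toℕ F) i j (s≤s⁻¹ (toℕ<n F)) (n≢0⇒n>0 j≢0) (≤∧≢⇒< j≤ℓ j≢ℓ)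
                    (proj₂ (proj₂ (proj₂ (internal-position (P i′) int))))
      ... | refl , refl = refl

  -- An edge of P i inside H joins consecutive positions on a ramp, so its ends get different colours.
  along-ramp : ∀ i t {x y} → t < ℓ i → P i at t ≡ x → P i at suc t ≡ y → (x ∈ VH) × (y ∈ VH) → U x ≢ U y
  along-ramp i t t<ℓ refl refl (x∈H , y∈H) same =
    C.colour-proper i t t<ℓ (∈H⇒on-ramp i t x∈H) (∈H⇒on-ramp i (suc t) y∈H)
      (trans (sym (U-on-path i t (<⇒≤ t<ℓ))) (trans same (U-on-path i (suc t) t<ℓ)))

  U-proper : ∀ u v → E H u v ≡ true → U u ≢ U v
  U-proper u v uv with E-cover u v (E⊆G H u v uv)
  ... | inj₁ ∈H' = λ same → c-proper u v ∈H' (trans (sym (U-on-H' u (proj₁ (E-ends H' u v ∈H'))))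
                                               (trans same (U-on-H' v (proj₂ (E-ends H' u v ∈H')))))
  ... | inj₂ (i , e) with edge-position (P i) e
  ...   | t , t<ℓ , inj₁ (here , next) = along-ramp i t t<ℓ here next (E-ends H u v uv)
  ...   | t , t<ℓ , inj₂ (here , next) = λ same → along-ramp i t t<ℓ here next (swap (E-ends H u v uv)) (sym same)

  segment-odd-long : ∀ i → Odd (C.b i ∸ C.a i) × (m ∸ 2 ≤ C.b i ∸ C.a i)
  segment-odd-long i with segment-length (C.κ i) (ℓ i)
  ... | inj₁ same    = subst Odd (sym same) (proj₁ (P-long i))
                     , subst (m ∸ 2 ≤_) (sym same) (≤-trans (m∸n≤m m 2) (proj₂ (P-long i)))
  ... | inj₂ shorter = subst Odd (sym shorter) (odd-∸2 (proj₁ (P-long i)) (3≤ℓ i))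
                     , subst (m ∸ 2 ≤_) (sym shorter) (∸-monoˡ-≤ 2 (proj₂ (P-long i)))

  -- H is induced, so a V(H)-path of G − E(H) has at least two edges.
  no-chord : ∀ (Q : Path (AdjMinus G H)) → IsAPath (V H) Q → 2 ≤ len Q
  no-chord Q Q-path@(1≤len , start∈H , end∈H , _) with len Q ≤? 1
  ... | no len≰1 = ≰⇒> len≰1
  ... | yes len≤1 = ⊥-elim (true≢false (trans (sym (induced-edge G VH start∈H next∈H (proj₁ first-edge)))
                                               (proj₂ first-edge)))
    where
      first-edge = at-step Q 0 1≤len
      next∈H : Q at 1 ∈ VH
      next∈H = subst (_∈ VH) (sym (at-end Q 1 len≤1)) end∈H
      true≢false : true ≢ false
      true≢false ()

  segment-paths : ∀ (Q : Path (AdjMinus G H)) → IsAPath (V H) Q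
                  → Odd (len Q) × (m ∸ 2 ≤ len Q)
                    × (((U (start Q) ≡ fzero) × (U (end Q) ≡ fsuc fzero))
                       ⊎ ((U (start Q) ≡ fsuc fzero) × (U (end Q) ≡ fzero)))
  segment-paths Q Q-path with V-cover (Q at 1)
  ... | inj₁ ∈H' = ⊥-elim (at-avoids Q Q-path 1 (s≤s z≤n) (no-chord Q Q-path) (p⊆p∪q _ ∈H'))
  ... | inj₂ (i , int) with internal-position (P i) int
  ...   | t , _ , _ , P-at-t with ∉H⇒inside i t (λ ∈H → at-avoids Q Q-path 1 (s≤s z≤n) (no-chord Q Q-path) (subst (_∈ VH) P-at-t ∈H))
  ...     | a<t , t<b with traverse (segment i) Q Q-path (no-chord Q Q-path) t a<t t<b (sym P-at-t)
  ...       | len≡ , ends = subst Odd (sym len≡) (proj₁ (segment-odd-long i))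
                          , subst (m ∸ 2 ≤_) (sym len≡) (proj₂ (segment-odd-long i))
                          , colours ends
    where
      U-a : U (P i at C.a i) ≡ fzero
      U-a = trans (U-on-path i (C.a i) (<⇒≤ (<-≤-trans (C.a<b i) (C.b≤ℓ i)))) (C.colour-a i)
      U-b : U (P i at C.b i) ≡ fsuc fzero
      U-b = trans (U-on-path i (C.b i) (C.b≤ℓ i)) (C.colour-b i)
      colours : ((start Q ≡ P i at C.a i) × (end Q ≡ P i at C.b i)) ⊎ ((start Q ≡ P i at C.b i) × (end Q ≡ P i at C.a i))
              → ((U (start Q) ≡ fzero) × (U (end Q) ≡ fsuc fzero)) ⊎ ((U (start Q) ≡ fsuc fzero) × (U (end Q) ≡ fzero))
      colours (inj₁ (s , e)) = inj₁ (trans (cong U s) U-a , trans (cong U e) U-b)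
      colours (inj₂ (s , e)) = inj₂ (trans (cong U s) U-b , trans (cong U e) U-a)

-- The theorem: H and U are those of the construction.
fact5 : ∀ {n} (G : Graph n) (H' : Subgraph G) (m : ℕ) → 3 ≤ m
    → Tripartite (AdjG G) → Tripartite (λ u v → E H' u v ≡ true)
    → ObtainedByPaths G H' m
    → Σ (Subgraph G) λ H → (H' ⊑ H) × (∣V∣ H ≤ 3 * ∣V∣ H')
    × Σ (Fin n → Fin 3) λ U
    → (∀ u v → E H u v ≡ true → U u ≢ U v)
    × (∀ (P : Path (AdjMinus G H)) → IsAPath (V H) P
    → Odd (len P) × (m ∸ 2 ≤ len P)
    × (((U (start P) ≡ fzero) × (U (end P) ≡ fsuc fzero))
    ⊎ ((U (start P) ≡ fsuc fzero) × (U (end P) ≡ fzero))))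
fact5 G H' m 3≤m _ (c , c-proper) (k , P , k≤∣H'∣ , P-paths , P-long , P-disjoint , V-cover , E-cover) =
  H , H'⊑H , ∣H∣≤3∣H'∣ , U , U-proper , segment-paths
  where
    open Construction G H' m 3≤m c c-proper k P k≤∣H'∣ P-paths P-long P-disjoint V-cover E-cover
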